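{- Let $m,n$ be nonnegative integers with $2m+n\ge 6$. Then there is no code $C$ in $D(m,n)$ with $|C|=4^{2m+n-2}$ and code distance $3$.
   Context: The Shrikhande graph $\mathrm{Sh}$ is the Cayley graph on $\mathbb{Z}_4^2$ with connection set $\{01,03,10,30,11,33\}$; $K$ is the complete graph on $\mathbb{Z}_4$. $D(m,n)$ is the Cartesian product of $m$ copies of $\mathrm{Sh}$ and $n$ copies of $K$, with distance equal to the sum of coordinatewise graph distances. The code distance of a code is the minimum distance between distinct codewords. -}

module Defs where

open import Data.Nat using (ℕ; zero; suc; _+_; _*_; _^_; _∸_; _≤_)
open import Data.Fin using (Fin; zero; suc)
open import Data.Fin using (_≟_; toℕ)
open import Data.Nat.DivMod using (_mod_)
open import Data.Bool using (Bool; true; false; _∨_; _∧_; if_then_else_)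
open import Data.Product using (_×_; _,_)
open import Data.Vec using (Vec; []; _∷_)
open import Data.List using (List; []; _∷_)
open import Data.Bool.ListAction using (any)
open import Data.List using (allFin) renaming (map to lmap)
open import Relation.Nullary.Decidable using (⌊_⌋)

Z4 : Set
Z4 = Fin 4

negZ4 : Z4 → Z4
negZ4 zero = zero
negZ4 (suc zero) = suc (suc (suc zero))
negZ4 (suc (suc zero)) = suc (suc zero)
negZ4 (suc (suc (suc zero))) = suc zero

addZ4 : Z4 → Z4 → Z4
addZ4 a b = (toℕ a + toℕ b) mod 4

subZ4 : Z4 → Z4 → Z4
subZ4 a b = addZ4 a (negZ4 b)

eqZ4 : Z4 → Z4 → Bool
eqZ4 a b = ⌊ a ≟ b ⌋

-- vertices of the Shrikhande graph: ℤ₄²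
ShV : Set
ShV = Z4 × Z4

eqSh : ShV → ShV → Bool
eqSh (a , b) (c , d) = eqZ4 a c ∧ eqZ4 b d

inConn : ShV → Bool
inConn (zero , suc zero) = true
inConn (zero , suc (suc (suc zero))) = true
inConn (suc zero , zero) = true
inConn (suc (suc (suc zero)) , zero) = true
inConn (suc zero , suc zero) = true
inConn (suc (suc (suc zero)) , suc (suc (suc zero))) = true
inConn _ = false

adjSh : ShV → ShV → Bool
adjSh (a , b) (c , d) = inConn (subZ4 c a , subZ4 d b)

adjK : Z4 → Z4 → Bool
adjK a b = if eqZ4 a b then false else true

module GraphDist {V : Set} (verts : List V) (eqV : V → V → Bool) (adj : V → V → Bool) where
  reach : ℕ → V → V → Bool
  reach zero x y = eqV x y
  reach (suc k) x y = reach k x y ∨ any (λ z → reach k x z ∧ adj z y) verts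

  -- least k ≤ bound with reach k x y (returns bound if none; graphs here are connected)
  distFrom : ℕ → ℕ → V → V → ℕ
  distFrom k zero x y = k
  distFrom k (suc fuel) x y = if reach k x y then k else distFrom (suc k) fuel x y

allZ4 : List Z4
allZ4 = allFin 4

allSh : List ShV
allSh = Data.List.concatMap (λ a → lmap (λ b → (a , b)) allZ4) allZ4

-- shortest-path distance in Sh (16 vertices, so paths of length ≤ 16 suffice)
distSh : ShV → ShV → ℕ
distSh = GraphDist.distFrom allSh eqSh adjSh 0 17

distK : Z4 → Z4 → ℕ
distK = GraphDist.distFrom allZ4 eqZ4 adjK 0 5

-- vertices of D(m,n) = Sh^m □ K^n
DV : ℕ → ℕ → Set
DV m n = Vec ShV m × Vec Z4 n

sumDistSh : ∀ {m} → Vec ShV m → Vec ShV m → ℕ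
sumDistSh [] [] = 0
sumDistSh (x ∷ xs) (y ∷ ys) = distSh x y + sumDistSh xs ys

sumDistK : ∀ {n} → Vec Z4 n → Vec Z4 n → ℕ
sumDistK [] [] = 0
sumDistK (x ∷ xs) (y ∷ ys) = distK x y + sumDistK xs ys

distD : ∀ {m n} → DV m n → DV m n → ℕ
distD (xs , us) (ys , vs) = sumDistSh xs ys + sumDistK us vs

module Submission where

-- The proof is the sphere-packing (Hamming) bound.  In D(m,n) every vertex
-- has exactly 6m + 3n neighbours, so the ball of radius 1 around a vertex
-- has 1 + 6m + 3n ≥ 19 elements once 2m + n ≥ 6.  In a code of minimum
-- distance 3 the radius-1 balls around distinct codewords are disjoint, so
-- 4^(2m+n-2) codewords would need 4^(2m+n-2) · 19 > 4^(2m+n) vertices.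

open import Defs
open import Data.Nat using (ℕ; _+_; _*_; _^_; _∸_; _≤_)
open import Data.List using (List; length)
open import Data.List.Membership.Propositional using (_∈_)
open import Data.List.Relation.Unary.Unique.Propositional using (Unique)
open import Data.Product using (Σ; _×_; ∃-syntax)
open import Relation.Binary.PropositionalEquality using (_≡_; _≢_)
open import Relation.Nullary using (¬_)

open import Data.Nat using (zero; suc; _<_; _≤?_; z≤n; s≤s)
open import Data.Nat.Properties
open import Data.Nat.Solver using (module +-*-Solver)
open import Data.Fin using (Fin)
open import Data.Fin.Properties using (all?; injective⇒≤) renaming (_≟_ to _≟ᶠ_)
open import Data.Product using (_,_; proj₁; proj₂; uncurry)
open import Data.Product.Properties using (≡-dec)
open import Data.Sum using ([_,_]′)
open import Data.Unit using (tt)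
open import Data.Empty using (⊥)
open import Data.Vec using (Vec; []; _∷_; uncons)
open import Data.List using ([]; _∷_; _++_; map; concatMap; lookup; cartesianProduct)
open import Data.List.Properties using (length-++; length-map)
open import Data.List.Membership.Propositional using (_∉_)
open import Data.List.Membership.Propositional.Properties
  using (∈-lookup; ∈-++⁻; ∈-map⁺; ∈-map⁻; ∈-cartesianProduct⁺)
import Data.List.Membership.DecPropositional as DecMembership
import Data.List.Membership.Setoid.Properties as SetoidMembership
open import Data.List.Relation.Unary.All as All using (All; []; _∷_)
import Data.List.Relation.Unary.All.Properties as All
open import Data.List.Relation.Unary.AllPairs as AllPairs using (AllPairs; []; _∷_)
import Data.List.Relation.Unary.AllPairs.Properties as AllPairs
open import Data.List.Relation.Unary.Any using (here; there; index)
import Data.List.Relation.Unary.Unique.Propositional.Properties as Unique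
open import Data.List.Relation.Binary.Disjoint.Propositional using (Disjoint)
open import Relation.Nullary using (Dec; yes; no; contradiction)
open import Relation.Nullary.Decidable using (toWitness; map′; _→-dec_; ¬?)
open import Relation.Binary.PropositionalEquality
  using (refl; sym; trans; cong; cong₂; subst; setoid; module ≡-Reasoning)

private
  variable
    A B : Set
    s r : ℕ

unique-lookup-injective : {xs : List A} → Unique xs →
  ∀ {i j} → lookup xs i ≡ lookup xs j → i ≡ j
unique-lookup-injective (_ ∷ _) {Fin.zero} {Fin.zero} _ = refl
unique-lookup-injective (x∉ ∷ _) {Fin.zero} {Fin.suc j} e = contradiction e (All.lookup x∉ (∈-lookup j))
unique-lookup-injective (x∉ ∷ _) {Fin.suc i} {Fin.zero} e = contradiction (sym e) (All.lookup x∉ (∈-lookup i))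
unique-lookup-injective (_ ∷ u) {Fin.suc i} {Fin.suc j} e = cong Fin.suc (unique-lookup-injective u e)

unique-⊆-length : {xs ys : List A} → Unique xs → (∀ {x} → x ∈ xs → x ∈ ys) →
  length xs ≤ length ys
unique-⊆-length {A = A} {xs} {ys} u xs⊆ys = injective⇒≤ position-injective
  where
  position : Fin (length xs) → Fin (length ys)
  position i = index (xs⊆ys (∈-lookup i))

  position-injective : ∀ {i j} → position i ≡ position j → i ≡ j
  position-injective {i} {j} e = unique-lookup-injective u
    (SetoidMembership.index-injective (setoid A) (xs⊆ys (∈-lookup i)) (xs⊆ys (∈-lookup j)) e)

length-cartesianProduct : (xs : List A) (ys : List B) →
  length (cartesianProduct xs ys) ≡ length xs * length ys
length-cartesianProduct [] ys = refl
length-cartesianProduct (x ∷ xs) ys = begin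
  length (map (x ,_) ys ++ cartesianProduct xs ys)     ≡⟨ length-++ (map (x ,_) ys) ⟩
  length (map (x ,_) ys) + length (cartesianProduct xs ys)
    ≡⟨ cong₂ _+_ (length-map (x ,_) ys) (length-cartesianProduct xs ys) ⟩
  length ys + length xs * length ys                    ∎
  where open ≡-Reasoning

length-concatMap-const : (f : A → List B) {L : ℕ} → (∀ x → length (f x) ≡ L) →
  ∀ xs → length (concatMap f xs) ≡ length xs * L
length-concatMap-const f fL [] = refl
length-concatMap-const f fL (x ∷ xs) =
  trans (length-++ (f x)) (cong₂ _+_ (fL x) (length-concatMap-const f fL xs))

allPairs-map∈ : {R S : A → A → Set} {xs : List A} →
  (∀ {x y} → x ∈ xs → y ∈ xs → R x y → S x y) → AllPairs R xs → AllPairs S xs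
allPairs-map∈ f [] = []
allPairs-map∈ f (Rx ∷ Rxs) =
  All.tabulate (λ y∈ → f (here refl) (there y∈) (All.lookup Rx y∈))
  ∷ allPairs-map∈ (λ x∈ y∈ → f (there x∈) (there y∈)) Rxs

record Space (A : Set) (size degree : ℕ) : Set where
  field
    dist            : A → A → ℕ
    dist-refl       : ∀ x → dist x x ≡ 0
    dist-sym        : ∀ x y → dist x y ≡ dist y x
    dist-triangle   : ∀ x y z → dist x z ≤ dist x y + dist y z
    nbrs            : A → List A
    nbrs-unique     : ∀ x → Unique (nbrs x)
    nbrs-irrefl     : ∀ x → x ∉ nbrs x
    nbrs-close      : ∀ x → All (λ y → dist x y ≤ 1) (nbrs x)
    nbrs-length     : ∀ x → length (nbrs x) ≡ degree
    points          : List A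
    points-complete : ∀ x → x ∈ points
    points-length   : length points ≡ size

  ball : A → List A
  ball x = x ∷ nbrs x

  ball-unique : ∀ x → Unique (ball x)
  ball-unique x = All.¬Any⇒All¬ (nbrs x) (nbrs-irrefl x) ∷ nbrs-unique x

  ball-length : ∀ x → length (ball x) ≡ suc degree
  ball-length x = cong suc (nbrs-length x)

  ball-close : ∀ x {z} → z ∈ ball x → dist x z ≤ 1
  ball-close x (here refl) = subst (_≤ 1) (sym (dist-refl x)) z≤n
  ball-close x (there z∈) = All.lookup (nbrs-close x) z∈

  ball-disjoint : ∀ x y → 3 ≤ dist x y → Disjoint (ball x) (ball y)
  ball-disjoint x y 3≤d {z} (z∈x , z∈y) = <⇒≱ (s≤s (s≤s (s≤s z≤n))) (begin
    3                   ≤⟨ 3≤d ⟩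
    dist x y            ≤⟨ dist-triangle x z y ⟩
    dist x z + dist z y ≡⟨ cong (dist x z +_) (dist-sym z y) ⟩
    dist x z + dist y z ≤⟨ +-mono-≤ (ball-close x z∈x) (ball-close y z∈y) ⟩
    2                   ∎)
    where open ≤-Reasoning

hamming-bound : (S : Space A s r) (C : List A) → Unique C →
  (∀ x y → x ∈ C → y ∈ C → x ≢ y → 3 ≤ Space.dist S x y) →
  length C * suc r ≤ s
hamming-bound {s = s} {r = r} S C C-unique C-separated = begin
  length C * suc r       ≡⟨ length-concatMap-const ball ball-length C ⟨
  length (concatMap ball C) ≤⟨ unique-⊆-length balls-unique (λ {x} _ → points-complete x) ⟩
  length points          ≡⟨ points-length ⟩
  s                      ∎
  where
  open Space S
  open ≤-Reasoning

  balls-unique : Unique (concatMap ball C)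
  balls-unique = Unique.concat⁺
    (All.map⁺ (All.tabulate (λ {x} _ → ball-unique x)))
    (AllPairs.map⁺ (allPairs-map∈
      (λ {x} {y} x∈ y∈ x≢y → ball-disjoint x y (C-separated x y x∈ y∈ x≢y)) C-unique))

-- In a distance with values in {0,1,2} that vanishes only on the diagonal,
-- the triangle inequality holds automatically: either one of the two legs
-- is trivial, or both have length ≥ 1 and so add up to at least 2.
triangle-of-diameter≤2 : (d : A → A → ℕ) → (∀ x y → d x y ≡ 0 → x ≡ y) →
  (∀ x y → d x y ≤ 2) → ∀ x y z → d x z ≤ d x y + d y z
triangle-of-diameter≤2 d d-zero d≤2 x y z with d x y ≟ 0 | d y z ≟ 0
... | yes dxy≡0 | _ rewrite d-zero x y dxy≡0 = m≤n+m (d y z) (d y y)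
... | no _ | yes dyz≡0 rewrite d-zero y z dyz≡0 = m≤m+n (d x z) (d z z)
... | no dxy≢0 | no dyz≢0 = ≤-trans (d≤2 x z) (+-mono-≤ (n≢0⇒n>0 dxy≢0) (n≢0⇒n>0 dyz≢0))

product : {A B : Set} {s₁ r₁ s₂ r₂ : ℕ} →
  Space A s₁ r₁ → Space B s₂ r₂ → Space (A × B) (s₁ * s₂) (r₁ + r₂)
product {A} {B} {r₁ = r₁} {r₂ = r₂} S T = record
  { dist            = dist
  ; dist-refl       = λ (a , b) → cong₂ _+_ (S.dist-refl a) (T.dist-refl b)
  ; dist-sym        = λ (a , b) (a′ , b′) → cong₂ _+_ (S.dist-sym a a′) (T.dist-sym b b′)
  ; dist-triangle   = triangle
  ; nbrs            = nbrs
  ; nbrs-unique     = nbrs-unique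
  ; nbrs-irrefl     = nbrs-irrefl
  ; nbrs-close      = nbrs-close
  ; nbrs-length     = nbrs-length
  ; points          = cartesianProduct S.points T.points
  ; points-complete = λ (a , b) → ∈-cartesianProduct⁺ (S.points-complete a) (T.points-complete b)
  ; points-length   = trans (length-cartesianProduct S.points T.points)
                            (cong₂ _*_ S.points-length T.points-length)
  }
  where
  module S = Space S
  module T = Space T

  dist : A × B → A × B → ℕ
  dist (a , b) (a′ , b′) = S.dist a a′ + T.dist b b′

  open +-*-Solver using (solve; _:+_; _:=_)

  interchange : ∀ p q p′ q′ → (p + q) + (p′ + q′) ≡ (p + p′) + (q + q′)
  interchange = solve 4 (λ p q p′ q′ → (p :+ q) :+ (p′ :+ q′) := (p :+ p′) :+ (q :+ q′)) refl

  triangle : ∀ x y z → dist x z ≤ dist x y + dist y z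
  triangle (a , b) (a′ , b′) (a″ , b″) = ≤-trans
    (+-mono-≤ (S.dist-triangle a a′ a″) (T.dist-triangle b b′ b″))
    (≤-reflexive (sym (interchange (S.dist a a′) (T.dist b b′) (S.dist a′ a″) (T.dist b′ b″))))

  nbrs : A × B → List (A × B)
  nbrs (a , b) = map (_, b) (S.nbrs a) ++ map (a ,_) (T.nbrs b)

  nbrs-unique : ∀ x → Unique (nbrs x)
  nbrs-unique (a , b) = Unique.++⁺
    (Unique.map⁺ (cong proj₁) (S.nbrs-unique a))
    (Unique.map⁺ (cong proj₂) (T.nbrs-unique b))
    moves-disjoint
    where
    moves-disjoint : Disjoint (map (_, b) (S.nbrs a)) (map (a ,_) (T.nbrs b))
    moves-disjoint (p , q) with ∈-map⁻ (_, b) p | ∈-map⁻ (a ,_) q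
    ... | a′ , a′∈ , refl | _ , _ , e = S.nbrs-irrefl a (subst (_∈ S.nbrs a) (cong proj₁ e) a′∈)

  nbrs-irrefl : ∀ x → x ∉ nbrs x
  nbrs-irrefl (a , b) x∈ = [ first , second ]′ (∈-++⁻ (map (_, b) (S.nbrs a)) x∈)
    where
    first : (a , b) ∈ map (_, b) (S.nbrs a) → ⊥
    first p with ∈-map⁻ (_, b) p
    ... | a′ , a′∈ , e = S.nbrs-irrefl a (subst (_∈ S.nbrs a) (sym (cong proj₁ e)) a′∈)
    second : (a , b) ∈ map (a ,_) (T.nbrs b) → ⊥
    second q with ∈-map⁻ (a ,_) q
    ... | b′ , b′∈ , e = T.nbrs-irrefl b (subst (_∈ T.nbrs b) (sym (cong proj₂ e)) b′∈)

  dist-move₁ : ∀ a a′ b → dist (a , b) (a′ , b) ≡ S.dist a a′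
  dist-move₁ a a′ b = trans (cong (S.dist a a′ +_) (T.dist-refl b)) (+-identityʳ _)

  dist-move₂ : ∀ a b b′ → dist (a , b) (a , b′) ≡ T.dist b b′
  dist-move₂ a b b′ = cong (_+ T.dist b b′) (S.dist-refl a)

  nbrs-close : ∀ x → All (λ y → dist x y ≤ 1) (nbrs x)
  nbrs-close (a , b) = All.++⁺
    (All.map⁺ (All.map (λ {a′} → subst (_≤ 1) (sym (dist-move₁ a a′ b))) (S.nbrs-close a)))
    (All.map⁺ (All.map (λ {b′} → subst (_≤ 1) (sym (dist-move₂ a b b′))) (T.nbrs-close b)))

  nbrs-length : ∀ x → length (nbrs x) ≡ r₁ + r₂
  nbrs-length (a , b) = trans (length-++ (map (_, b) (S.nbrs a)))
    (cong₂ _+_ (trans (length-map (_, b) (S.nbrs a)) (S.nbrs-length a))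
               (trans (length-map (a ,_) (T.nbrs b)) (T.nbrs-length b)))

transport : (to : A → B) (from : B → A) →
  (∀ x → from (to x) ≡ x) → (∀ y → to (from y) ≡ y) →
  Space A s r → Space B s r
transport {B = B} to from from-to to-from S = record
  { dist            = λ y y′ → S.dist (from y) (from y′)
  ; dist-refl       = λ y → S.dist-refl (from y)
  ; dist-sym        = λ y y′ → S.dist-sym (from y) (from y′)
  ; dist-triangle   = λ y y′ y″ → S.dist-triangle (from y) (from y′) (from y″)
  ; nbrs            = nbrs
  ; nbrs-unique     = λ y → Unique.map⁺ to-injective (S.nbrs-unique (from y))
  ; nbrs-irrefl     = nbrs-irrefl
  ; nbrs-close      = λ y → All.map⁺ (All.map
      (λ {x} d≤1 → subst (λ x′ → S.dist (from y) x′ ≤ 1) (sym (from-to x)) d≤1) (S.nbrs-close (from y)))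
  ; nbrs-length     = λ y → trans (length-map to (S.nbrs (from y))) (S.nbrs-length (from y))
  ; points          = map to S.points
  ; points-complete = λ y → subst (_∈ map to S.points) (to-from y) (∈-map⁺ to (S.points-complete (from y)))
  ; points-length   = trans (length-map to S.points) S.points-length
  }
  where
  module S = Space S

  to-injective : ∀ {x x′} → to x ≡ to x′ → x ≡ x′
  to-injective {x} {x′} e = trans (sym (from-to x)) (trans (cong from e) (from-to x′))

  nbrs : B → List B
  nbrs y = map to (S.nbrs (from y))

  nbrs-irrefl : ∀ y → y ∉ nbrs y
  nbrs-irrefl y y∈ with ∈-map⁻ to y∈
  ... | x , x∈ , y≡to-x =
    S.nbrs-irrefl (from y) (subst (_∈ S.nbrs (from y)) (sym (trans (cong from y≡to-x) (from-to x))) x∈)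

vectors₀ : Space (Vec A 0) 1 0
vectors₀ = record
  { dist            = λ _ _ → 0
  ; dist-refl       = λ _ → refl
  ; dist-sym        = λ _ _ → refl
  ; dist-triangle   = λ _ _ _ → z≤n
  ; nbrs            = λ _ → []
  ; nbrs-unique     = λ _ → []
  ; nbrs-irrefl     = λ _ ()
  ; nbrs-close      = λ _ → []
  ; nbrs-length     = λ _ → refl
  ; points          = [] ∷ []
  ; points-complete = λ { [] → here refl }
  ; points-length   = refl
  }

power : Space A s r → (k : ℕ) → Space (Vec A k) (s ^ k) (k * r)
power S zero = vectors₀
power S (suc k) = transport (uncurry _∷_) uncons (λ _ → refl) (λ { (_ ∷ _) → refl })
  (product S (power S k))

-- Finite facts about Sh and K₄ are decided by evaluation; the proofs are
-- kept abstract so that they are not unfolded again by later definitions.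
_≟Sh_ : (x y : ShV) → Dec (x ≡ y)
_≟Sh_ = ≡-dec _≟ᶠ_ _≟ᶠ_

all-Sh? : {P : ShV → Set} → (∀ x → Dec (P x)) → Dec (∀ x → P x)
all-Sh? P? = map′ (λ h (a , b) → h a b) (λ h a b → h (a , b)) (all? λ a → all? λ b → P? (a , b))

connection : List ShV
connection = (z , o) ∷ (z , t) ∷ (o , z) ∷ (t , z) ∷ (o , o) ∷ (t , t) ∷ []
  where
  z o t : Z4
  z = Fin.zero
  o = Fin.suc Fin.zero
  t = negZ4 o

nbrs-Sh : ShV → List ShV
nbrs-Sh (a , b) = map (λ (c , d) → addZ4 a c , addZ4 b d) connection

abstract
  distSh-refl : ∀ x → distSh x x ≡ 0
  distSh-refl = toWitness {a? = all-Sh? λ x → distSh x x ≟ 0} tt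

  distSh-zero : ∀ x y → distSh x y ≡ 0 → x ≡ y
  distSh-zero = toWitness {a? = all-Sh? λ x → all-Sh? λ y → (distSh x y ≟ 0) →-dec (x ≟Sh y)} tt

  distSh-sym : ∀ x y → distSh x y ≡ distSh y x
  distSh-sym = toWitness {a? = all-Sh? λ x → all-Sh? λ y → distSh x y ≟ distSh y x} tt

  distSh≤2 : ∀ x y → distSh x y ≤ 2
  distSh≤2 = toWitness {a? = all-Sh? λ x → all-Sh? λ y → distSh x y ≤? 2} tt

  nbrs-Sh-unique : ∀ x → Unique (nbrs-Sh x)
  nbrs-Sh-unique = toWitness {a? = all-Sh? λ x → AllPairs.allPairs? (λ y z → ¬? (y ≟Sh z)) (nbrs-Sh x)} tt

  nbrs-Sh-irrefl : ∀ x → x ∉ nbrs-Sh x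
  nbrs-Sh-irrefl = toWitness {a? = all-Sh? λ x → ¬? (x ∈Sh? nbrs-Sh x)} tt
    where open DecMembership _≟Sh_ renaming (_∈?_ to _∈Sh?_)

  nbrs-Sh-close : ∀ x → All (λ y → distSh x y ≤ 1) (nbrs-Sh x)
  nbrs-Sh-close = toWitness {a? = all-Sh? λ x → All.all? (λ y → distSh x y ≤? 1) (nbrs-Sh x)} tt

  allSh-complete : ∀ x → x ∈ allSh
  allSh-complete = toWitness {a? = all-Sh? λ x → x ∈Sh? allSh} tt
    where open DecMembership _≟Sh_ renaming (_∈?_ to _∈Sh?_)

shrikhande : Space ShV 16 6
shrikhande = record
  { dist            = distSh
  ; dist-refl       = distSh-refl
  ; dist-sym        = distSh-sym
  ; dist-triangle   = triangle-of-diameter≤2 distSh distSh-zero distSh≤2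
  ; nbrs            = nbrs-Sh
  ; nbrs-unique     = nbrs-Sh-unique
  ; nbrs-irrefl     = nbrs-Sh-irrefl
  ; nbrs-close      = nbrs-Sh-close
  ; nbrs-length     = λ _ → refl
  ; points          = allSh
  ; points-complete = allSh-complete
  ; points-length   = refl
  }

nbrs-K : Z4 → List Z4
nbrs-K a = map (addZ4 a) nonzero
  where
  nonzero : List Z4
  nonzero = Fin.suc Fin.zero ∷ Fin.suc (Fin.suc Fin.zero) ∷ negZ4 (Fin.suc Fin.zero) ∷ []

abstract
  distK-refl : ∀ a → distK a a ≡ 0
  distK-refl = toWitness {a? = all? λ a → distK a a ≟ 0} tt

  distK-zero : ∀ a b → distK a b ≡ 0 → a ≡ b
  distK-zero = toWitness {a? = all? λ a → all? λ b → (distK a b ≟ 0) →-dec (a ≟ᶠ b)} tt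

  distK-sym : ∀ a b → distK a b ≡ distK b a
  distK-sym = toWitness {a? = all? λ a → all? λ b → distK a b ≟ distK b a} tt

  distK≤2 : ∀ a b → distK a b ≤ 2
  distK≤2 = toWitness {a? = all? λ a → all? λ b → distK a b ≤? 2} tt

  nbrs-K-unique : ∀ a → Unique (nbrs-K a)
  nbrs-K-unique = toWitness {a? = all? λ a → AllPairs.allPairs? (λ b c → ¬? (b ≟ᶠ c)) (nbrs-K a)} tt

  nbrs-K-irrefl : ∀ a → a ∉ nbrs-K a
  nbrs-K-irrefl = toWitness {a? = all? λ a → ¬? (a ∈K? nbrs-K a)} tt
    where open DecMembership (_≟ᶠ_ {4}) renaming (_∈?_ to _∈K?_)

  nbrs-K-close : ∀ a → All (λ b → distK a b ≤ 1) (nbrs-K a)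
  nbrs-K-close = toWitness {a? = all? λ a → All.all? (λ b → distK a b ≤? 1) (nbrs-K a)} tt

  allZ4-complete : ∀ a → a ∈ allZ4
  allZ4-complete = toWitness {a? = all? λ a → a ∈K? allZ4} tt
    where open DecMembership (_≟ᶠ_ {4}) renaming (_∈?_ to _∈K?_)

complete₄ : Space Z4 4 3
complete₄ = record
  { dist            = distK
  ; dist-refl       = distK-refl
  ; dist-sym        = distK-sym
  ; dist-triangle   = triangle-of-diameter≤2 distK distK-zero distK≤2
  ; nbrs            = nbrs-K
  ; nbrs-unique     = nbrs-K-unique
  ; nbrs-irrefl     = nbrs-K-irrefl
  ; nbrs-close      = nbrs-K-close
  ; nbrs-length     = λ _ → refl
  ; points          = allZ4
  ; points-complete = allZ4-complete
  ; points-length   = refl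
  }

D : (m n : ℕ) → Space (DV m n) (16 ^ m * 4 ^ n) (m * 6 + n * 3)
D m n = product (power shrikhande m) (power complete₄ n)

distD-is-dist : ∀ {m n} (x y : DV m n) → distD x y ≡ Space.dist (D m n) x y
distD-is-dist (xs , us) (ys , vs) = cong₂ _+_ (sh-coordinates xs ys) (k-coordinates us vs)
  where
  sh-coordinates : ∀ {k} (xs ys : Vec ShV k) → sumDistSh xs ys ≡ Space.dist (power shrikhande k) xs ys
  sh-coordinates [] [] = refl
  sh-coordinates (x ∷ xs) (y ∷ ys) = cong (distSh x y +_) (sh-coordinates xs ys)

  k-coordinates : ∀ {k} (us vs : Vec Z4 k) → sumDistK us vs ≡ Space.dist (power complete₄ k) us vs
  k-coordinates [] [] = refl
  k-coordinates (u ∷ us) (v ∷ vs) = cong (distK u v +_) (k-coordinates us vs)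

-- Volume count: for 2m + n ≥ 6, 4^(2m+n-2) balls of size 1 + 6m + 3n ≥ 19
-- have more elements than the 16ᵐ · 4ⁿ = 4^(2m+n-2) · 16 vertices of D(m,n).
volume-too-large : ∀ m n → 6 ≤ 2 * m + n →
  16 ^ m * 4 ^ n < 4 ^ (2 * m + n ∸ 2) * suc (m * 6 + n * 3)
volume-too-large m n 6≤N = begin-strict
  16 ^ m * 4 ^ n         ≡⟨ cong (_* 4 ^ n) (^-*-assoc 4 2 m) ⟩
  4 ^ (2 * m) * 4 ^ n    ≡⟨ ^-distribˡ-+-* 4 (2 * m) n ⟨
  4 ^ N                  ≡⟨ cong (4 ^_) (m+[n∸m]≡n (≤-trans (s≤s (s≤s z≤n)) 6≤N)) ⟨
  4 ^ (2 + (N ∸ 2))      ≡⟨ *-assoc 4 4 p ⟨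
  16 * p                 ≡⟨ *-comm 16 p ⟩
  p * 16                 <⟨ *-monoʳ-< p {{m^n≢0 4 (N ∸ 2)}} (m≤m+n 17 2) ⟩
  p * 19                 ≤⟨ *-monoʳ-≤ p (s≤s 18≤L) ⟩
  p * suc (m * 6 + n * 3) ∎
  where
  open ≤-Reasoning
  open +-*-Solver using (solve; _:*_; _:+_; _:=_; con)
  N = 2 * m + n
  p = 4 ^ (N ∸ 2)

  18≤L : 18 ≤ m * 6 + n * 3
  18≤L = subst (18 ≤_)
    (solve 2 (λ a b → con 3 :* (con 2 :* a :+ b) := a :* con 6 :+ b :* con 3) refl m n)
    (*-monoʳ-≤ 3 6≤N)

lemma15 : (m n : ℕ) → 6 ≤ 2 * m + n →
    ¬ (Σ (List (DV m n)) λ C →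
         Unique C
         × length C ≡ 4 ^ (2 * m + n ∸ 2)
         × (∀ x y → x ∈ C → y ∈ C → x ≢ y → 3 ≤ distD x y)
         × (∃[ x ] ∃[ y ] (x ∈ C × y ∈ C × x ≢ y × distD x y ≡ 3)))
lemma15 m n 6≤N (C , C-unique , |C|≡ , C-separated , _) =
  <⇒≱ (volume-too-large m n 6≤N) (subst (λ c → c * suc (m * 6 + n * 3) ≤ 16 ^ m * 4 ^ n) |C|≡ packing)
  where
  packing : length C * suc (m * 6 + n * 3) ≤ 16 ^ m * 4 ^ n
  packing = hamming-bound (D m n) C C-unique
    (λ x y x∈ y∈ x≢y → subst (3 ≤_) (distD-is-dist x y) (C-separated x y x∈ y∈ x≢y))
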